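{- Let $C$ be a cycle whose vertex set is partitioned into three nonempty sets $V_1,V_2,V_3$, each of which is the vertex set of a subpath of $C$. Let $S$ be a nonempty set of vertices disjoint from $V(C)$, and let $\widehat C$ be a graph with vertex set $V(C)\cup S$ whose edges are the edges of $C$ together with edges between $S$ and $V(C)$, such that every vertex of $S$ has exactly one neighbour in each of $V_1,V_2,V_3$ and every vertex of $C$ has at most one neighbour in $S$. For every vertex $v\in V(C)$ of degree $2$ in $\widehat C$, let $P(v)$ be the unique path in $C$ containing $v$ whose first and last vertices have degree $3$ in $\widehat C$ and all of whose other vertices have degree $2$ in $\widehat C$. Then every graph $\widetilde C$ obtained from $\widehat C$ by adding, for every vertex $v\in V(C)$ of degree $2$ in $\widehat C$, an edge from $v$ to some vertex of $V(\widehat C)\setminus V(P(v))$, is $3$-connected.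
   Context: A graph $G$ is $3$-connected if $|V(G)|\ge 4$ and removing any set of at most $2$ vertices leaves a connected graph. -}

module Defs where

open import Data.Bool using (Bool; true; false; if_then_else_; _∨_; _∧_)
open import Data.Nat using (ℕ; zero; suc; _+_; _≤_; _<_; _≡ᵇ_)
open import Data.Fin using (Fin; toℕ; splitAt; _↑ˡ_; _↑ʳ_)
import Data.Fin as F
open import Data.Sum using (_⊎_; inj₁; inj₂)
open import Data.Product using (Σ; ∃; _×_; _,_)
open import Data.List using (List; length)
open import Data.List.Membership.Propositional using (_∉_)
open import Relation.Binary.PropositionalEquality using (_≡_; _≢_)
open import Relation.Nullary using (¬_)

countB : ∀ {N} → (Fin N → Bool) → ℕ
countB {zero}  p = 0
countB {suc N} p = (if p F.zero then 1 else 0) + countB (λ x → p (F.suc x))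

degree : ∀ {N} → (Fin N → Fin N → Bool) → Fin N → ℕ
degree E x = countB (E x)

data Reach {N : ℕ} (E : Fin N → Fin N → Set) (X : List (Fin N)) (u : Fin N)
     : Fin N → Set where
  here : Reach E X u u
  step : ∀ {v w} → Reach E X u v → (E v w ⊎ E w v) → w ∉ X → Reach E X u w

ThreeConnected : ∀ {N} → (Fin N → Fin N → Set) → Set
ThreeConnected {N} E =
  4 ≤ N ×
  ((X : List (Fin N)) → length X ≤ 2 →
     ∀ u w → u ∉ X → w ∉ X → Reach E X u w)

-- The cycle C on vertex set Fin n : edges {i, i+1 mod n}

cycAdjᵇ : ∀ {n} → Fin n → Fin n → Bool
cycAdjᵇ {n} u v =
  (suc (toℕ u) ≡ᵇ toℕ v) ∨ (suc (toℕ v) ≡ᵇ toℕ u) ∨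
  ((suc (toℕ u) ≡ᵇ n) ∧ (toℕ v ≡ᵇ 0)) ∨ ((suc (toℕ v) ≡ᵇ n) ∧ (toℕ u ≡ᵇ 0))

-- v is the vertex s + j (mod n) of C  (used with j < n, s < n)
AtArc : ∀ {n} → Fin n → ℕ → Fin n → Set
AtArc {n} s j v = (toℕ s + j ≡ toℕ v) ⊎ (toℕ s + j ≡ n + toℕ v)

-- v lies on the subpath s, s+1, ..., s+k of C  (a subpath when k < n)
OnArc : ∀ {n} → Fin n → ℕ → Fin n → Set
OnArc s k v = ∃ λ j → j ≤ k × AtArc s j v

IsSubpathSet : ∀ {n} → (Fin n → Set) → Set
IsSubpathSet {n} A =
  Σ (Fin n) λ s → Σ ℕ λ k → k < n ×
    (∀ v → (A v → OnArc s k v) × (OnArc s k v → A v))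

-- The graph Ĉ on vertex set V(C) ⊎ S, encoded as Fin (n + m):
-- cycle vertex v is  v ↑ˡ m,  vertex s of S is  n ↑ʳ s.
-- adj s v : s ∈ S adjacent to v ∈ V(C)

hatE : ∀ {n m} → (Fin m → Fin n → Bool) → Fin (n + m) → Fin (n + m) → Bool
hatE {n} adj x y with splitAt n x | splitAt n y
... | inj₁ u | inj₁ v = cycAdjᵇ u v
... | inj₁ u | inj₂ s = adj s u
... | inj₂ s | inj₁ u = adj s u
... | inj₂ _ | inj₂ _ = false

IsP : ∀ {n m} → (Fin m → Fin n → Bool) → Fin n → Fin n → ℕ → Set
IsP {n} {m} adj v s k =
  k < n × OnArc s k v ×
  degree (hatE adj) (s ↑ˡ m) ≡ 3 ×
  (∀ e → AtArc s k e → degree (hatE adj) (e ↑ˡ m) ≡ 3) ×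
  (∀ j u → 0 < j → j < k → AtArc s j u → degree (hatE adj) (u ↑ˡ m) ≡ 2)

tildeE : ∀ {n m} (adj : Fin m → Fin n → Bool) →
         ((v : Fin n) → degree (hatE adj) (v ↑ˡ m) ≡ 2 → Fin (n + m)) →
         Fin (n + m) → Fin (n + m) → Set
tildeE {n} {m} adj f x y =
  (hatE adj x y ≡ true) ⊎
  (Σ (Fin n) λ v → Σ (degree (hatE adj) (v ↑ˡ m) ≡ 2) λ d →
     (x ≡ v ↑ˡ m) × (y ≡ f v d))

-- Delete a set X of at most two vertices. A new vertex has three neighbours on C, one
-- in each part, so one of them survives; hence it suffices to join all surviving cycle
-- vertices to one hub. If at most one cycle vertex is deleted, the rest of C is a path.
-- If two cycle vertices c, c′ are deleted, no new vertex is, and C − {c, c′} is a path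
-- or two arcs A and B, which we must join. If both arcs carry attached vertices, with
-- new neighbours s and s′, then s or s′ has a neighbour on the other arc, or else the
-- neighbours of s and s′ in the third part (the one avoiding c and c′) lie on different
-- arcs; the latter is impossible, since that part is a subpath of C − {c, c′}. If, say,
-- A carries no attached vertex, the vertex v after c has degree 2 and P(v) contains c, A
-- and c′, so the added edge at v goes to B, or to a new vertex whose neighbour in the
-- third part cannot lie on A and hence lies on B.

module Submission where

open import Defs
open import Data.Bool using (Bool; true; false; T; if_then_else_; _∨_; _∧_)
open import Data.Bool.Properties using (T-∨; T-∧; T-≡; ¬-not; ∨-zeroʳ) renaming (_≟_ to _≟ᵇ_)
open import Data.Empty using (⊥; ⊥-elim)
open import Data.Fin using (Fin; toℕ; fromℕ<; splitAt; _↑ˡ_; _↑ʳ_)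
import Data.Fin as F
open import Data.Fin.Properties
  using (toℕ-injective; toℕ<n; toℕ-fromℕ<; splitAt-↑ˡ; splitAt-↑ʳ; splitAt⁻¹-↑ˡ; splitAt⁻¹-↑ʳ; ↑ˡ-injective; any?; pigeonhole)
  renaming (_≟_ to _≟ᶠ_; suc-injective to fsuc-injective)
open import Data.List using (List; []; _∷_; length; lookup)
open import Data.List.Membership.Propositional using (_∈_; _∉_)
open import Data.List.Relation.Unary.Any using (here; there; index)
open import Data.List.Relation.Unary.Any.Properties using (lookup-index)
open import Data.Nat
open import Data.Nat.DivMod
open import Data.Nat.Properties
open import Data.Product using (∃; _×_; _,_; proj₁; proj₂)
open import Data.Sum using (_⊎_; inj₁; inj₂; swap; [_,_])
open import Data.Sum.Function.Propositional using (_⊎-⇔_)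
open import Function using (_∘_; _⇔_; mk⇔; Equivalence; case_of_)
open import Function.Construct.Composition using (_⇔-∘_)
open import Function.Construct.Symmetry using (⇔-sym)
open import Function.Definitions using (Injective)
open import Relation.Binary.Definitions using (DecidableEquality; tri<; tri≈; tri>)
open import Relation.Binary.PropositionalEquality hiding ([_])
open import Relation.Nullary using (¬_; Dec; yes; no; contradiction; ¬?; decidable-stable; does)
open import Relation.Nullary.Decidable using (_×-dec_; dec-true; dec-false)
import Relation.Unary as U

module _ {N : ℕ} {E : Fin N → Fin N → Set} {X : List (Fin N)} where

  reach-trans : ∀ {u v w} → Reach E X u v → Reach E X v w → Reach E X u w
  reach-trans r here            = r
  reach-trans r (step r′ e w∉X) = step (reach-trans r r′) e w∉X

  reach-∉ : ∀ {u v} → u ∉ X → Reach E X u v → v ∉ X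
  reach-∉ u∉X here           = u∉X
  reach-∉ u∉X (step _ _ v∉X) = v∉X

  reach-sym : ∀ {u v} → u ∉ X → Reach E X u v → Reach E X v u
  reach-sym u∉X here           = here
  reach-sym u∉X (step r e w∉X) =
    reach-trans (step here (swap e) (reach-∉ u∉X r)) (reach-sym u∉X r)

  reach-edge : ∀ {u v} → E u v → v ∉ X → Reach E X u v
  reach-edge e = step here (inj₁ e)

  reach-edge⁻ : ∀ {u v} → E v u → v ∉ X → Reach E X u v
  reach-edge⁻ e = step here (inj₂ e)

countB-cong : ∀ {N} {p q : Fin N → Bool} → (∀ x → p x ≡ q x) → countB p ≡ countB q
countB-cong {zero}  p≗q = refl
countB-cong {suc N} p≗q rewrite p≗q F.zero = cong (_ +_) (countB-cong (p≗q ∘ F.suc))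

countB-false : ∀ {N} → countB {N} (λ _ → false) ≡ 0
countB-false {zero}  = refl
countB-false {suc N} = countB-false {N}

countB-suc : ∀ {N} {p q : Fin N → Bool} (a : Fin N) → p a ≡ true → q a ≡ false →
             (∀ x → x ≢ a → p x ≡ q x) → countB p ≡ suc (countB q)
countB-suc {suc N} F.zero pa qa p≗q rewrite pa | qa =
  cong suc (countB-cong (λ x → p≗q (F.suc x) λ ()))
countB-suc {suc N} {p} {q} (F.suc a) pa qa p≗q rewrite p≗q F.zero (λ ()) =
  trans (cong (_ +_) (countB-suc a pa qa (λ x x≢a → p≗q (F.suc x) (x≢a ∘ fsuc-injective))))
        (+-suc _ _)

countB-none : ∀ {N} {p : Fin N → Bool} → (∀ x → p x ≢ true) → countB p ≡ 0
countB-none {N} p≢true = trans (countB-cong (λ x → ¬-not (p≢true x))) (countB-false {N})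

countB-single : ∀ {N} {p : Fin N → Bool} (a : Fin N) → p a ≡ true →
                (∀ x → p x ≡ true → x ≡ a) → countB p ≡ 1
countB-single {N} a pa only-a =
  trans (countB-suc {q = λ _ → false} a pa refl (λ x x≢a → ¬-not (x≢a ∘ only-a x)))
        (cong suc (countB-false {N}))

countB-≟ : ∀ {N} (a : Fin N) → countB (λ x → does (x ≟ᶠ a)) ≡ 1
countB-≟ a = countB-single a (dec-true (a ≟ᶠ a) refl) (λ x → dec-true⁻¹ (x ≟ᶠ a))
  where dec-true⁻¹ : ∀ {A : Set} (a? : Dec A) → does a? ≡ true → A
        dec-true⁻¹ (yes a) _ = a

countB-+ : ∀ n {m} (p : Fin (n + m) → Bool) →
           countB p ≡ countB (λ v → p (v ↑ˡ m)) + countB (λ s → p (n ↑ʳ s))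
countB-+ zero    p = refl
countB-+ (suc n) p = trans (cong (p₀ +_) (countB-+ n (p ∘ F.suc))) (sym (+-assoc p₀ _ _))
  where p₀ : ℕ
        p₀ = if p F.zero then 1 else 0

module _ {P : ℕ → Set} (P? : U.Decidable P) where

  least : ∀ d → (∃ λ j → j < d × P j) → ∃ λ e → P e × (∀ {j} → j < e → ¬ P j)
  least (suc d) (w , w<1+d , pw) with anyUpTo? P? d
  ... | yes below = least d below
  ... | no none   = w , pw , λ j<w pj → none (_ , <-≤-trans j<w (s≤s⁻¹ w<1+d) , pj)

  greatest : ∀ d → (∃ λ j → j < d × P j) →
             ∃ λ b → b < d × P b × (∀ {j} → b < j → j < d → ¬ P j)
  greatest (suc d) (w , w<1+d , pw) with P? d
  ... | yes pd = d , ≤-refl , pd , λ d<j j<1+d _ → <-irrefl refl (<-≤-trans d<j (s≤s⁻¹ j<1+d))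
  ... | no ¬pd with greatest d (w , ≤∧≢⇒< (s≤s⁻¹ w<1+d) (λ { refl → ¬pd pw }) , pw)
  ...   | b , b<d , pb , above = b , m<n⇒m<1+n b<d , pb , λ b<j j<1+d →
            [ above b<j , (λ { refl → ¬pd }) ] (m≤n⇒m<n∨m≡n (s≤s⁻¹ j<1+d))

module _ {A : Set} where

  ¬injective-into-short : ∀ {k} {f : Fin k → A} → Injective _≡_ _≡_ f →
                          (X : List A) → length X < k → ¬ (∀ i → f i ∈ X)
  ¬injective-into-short {f = f} f-inj X |X|<k member with pigeonhole |X|<k (index ∘ member)
  ... | i , j , i<j , same-index = <⇒≢ i<j (cong toℕ (f-inj (begin
    f i                        ≡⟨ lookup-index (member i) ⟩
    lookup X (index (member i)) ≡⟨ cong (lookup X) same-index ⟩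
    lookup X (index (member j)) ≡⟨ lookup-index (member j) ⟨
    f j                        ∎)))
    where open ≡-Reasoning

module _ {A : Set} (_≟_ : DecidableEquality A) where
  open import Data.List.Membership.DecPropositional _≟_ using (_∈?_)

  injective-escapes : ∀ {k} {f : Fin k → A} → Injective _≡_ _≡_ f →
                      (X : List A) → length X < k → ∃ λ i → f i ∉ X
  injective-escapes {f = f} f-inj X |X|<k with any? (λ i → ¬? (f i ∈? X))
  ... | yes escapes = escapes
  ... | no  none    = contradiction (λ i → decidable-stable (f i ∈? X) (none ∘ (i ,_)))
                                    (¬injective-into-short f-inj X |X|<k)

-- at c p is the vertex p steps after c along C, and pos c v the number of steps from c to v.
module Cycle (n : ℕ) .{{_ : NonZero n}} where

  at : Fin n → ℕ → Fin n
  at c p = fromℕ< (m%n<n (toℕ c + p) n)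

  pos : Fin n → Fin n → ℕ
  pos c v = (toℕ v + (n ∸ toℕ c)) % n

  toℕ-at : ∀ c p → toℕ (at c p) ≡ (toℕ c + p) % n
  toℕ-at c p = toℕ-fromℕ< _

  pos<n : ∀ c v → pos c v < n
  pos<n c v = m%n<n _ n

  [a%n+b]%n≡[a+b]%n : ∀ a b → (a % n + b) % n ≡ (a + b) % n
  [a%n+b]%n≡[a+b]%n a b = begin
    (a % n + b) % n         ≡⟨ %-distribˡ-+ (a % n) b n ⟩
    (a % n % n + b % n) % n ≡⟨ cong (λ x → (x + b % n) % n) (m%n%n≡m%n a n) ⟩
    (a % n + b % n) % n     ≡⟨ %-distribˡ-+ a b n ⟨
    (a + b) % n             ∎
    where open ≡-Reasoning

  [b+a%n]%n≡[b+a]%n : ∀ b a → (b + a % n) % n ≡ (b + a) % n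
  [b+a%n]%n≡[b+a]%n b a = begin
    (b + a % n) % n ≡⟨ cong (_% n) (+-comm b (a % n)) ⟩
    (a % n + b) % n ≡⟨ [a%n+b]%n≡[a+b]%n a b ⟩
    (a + b) % n     ≡⟨ cong (_% n) (+-comm a b) ⟩
    (b + a) % n     ∎
    where open ≡-Reasoning

  at-cong : ∀ c {p q} → (toℕ c + p) % n ≡ (toℕ c + q) % n → at c p ≡ at c q
  at-cong c {p} {q} eq = toℕ-injective (trans (toℕ-at c p) (trans eq (sym (toℕ-at c q))))

  at-at : ∀ c a j → at (at c a) j ≡ at c (a + j)
  at-at c a j = toℕ-injective (begin
    toℕ (at (at c a) j)       ≡⟨ toℕ-at (at c a) j ⟩
    (toℕ (at c a) + j) % n    ≡⟨ cong (λ x → (x + j) % n) (toℕ-at c a) ⟩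
    ((toℕ c + a) % n + j) % n ≡⟨ [a%n+b]%n≡[a+b]%n (toℕ c + a) j ⟩
    (toℕ c + a + j) % n       ≡⟨ cong (_% n) (+-assoc (toℕ c) a j) ⟩
    (toℕ c + (a + j)) % n     ≡⟨ toℕ-at c (a + j) ⟨
    toℕ (at c (a + j))        ∎)
    where open ≡-Reasoning

  at-0 : ∀ c → at c 0 ≡ c
  at-0 c = toℕ-injective (trans (toℕ-at c 0)
    (trans (cong (_% n) (+-identityʳ (toℕ c))) (m<n⇒m%n≡m (toℕ<n c))))

  at-n+ : ∀ c p → at c (n + p) ≡ at c p
  at-n+ c p = at-cong c (begin
    (toℕ c + (n + p)) % n ≡⟨ cong (_% n) (trans (cong (toℕ c +_) (+-comm n p)) (sym (+-assoc (toℕ c) p n))) ⟩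
    (toℕ c + p + n) % n   ≡⟨ [m+n]%n≡m%n (toℕ c + p) n ⟩
    (toℕ c + p) % n       ∎)
    where open ≡-Reasoning

  at-% : ∀ c p → at c (p % n) ≡ at c p
  at-% c p = at-cong c ([b+a%n]%n≡[b+a]%n (toℕ c) p)

  c+x+[n∸c]≡x+n : ∀ (c : Fin n) x → toℕ c + x + (n ∸ toℕ c) ≡ x + n
  c+x+[n∸c]≡x+n c x = begin
    toℕ c + x + (n ∸ toℕ c)   ≡⟨ cong (_+ (n ∸ toℕ c)) (+-comm (toℕ c) x) ⟩
    x + toℕ c + (n ∸ toℕ c)   ≡⟨ +-assoc x (toℕ c) (n ∸ toℕ c) ⟩
    x + (toℕ c + (n ∸ toℕ c)) ≡⟨ cong (x +_) (m+[n∸m]≡n (<⇒≤ (toℕ<n c))) ⟩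
    x + n                     ∎
    where open ≡-Reasoning

  at-pos : ∀ c v → at c (pos c v) ≡ v
  at-pos c v = toℕ-injective (begin
    toℕ (at c (pos c v))                    ≡⟨ toℕ-at c (pos c v) ⟩
    (toℕ c + (toℕ v + (n ∸ toℕ c)) % n) % n ≡⟨ [b+a%n]%n≡[b+a]%n (toℕ c) _ ⟩
    (toℕ c + (toℕ v + (n ∸ toℕ c))) % n     ≡⟨ cong (_% n) (sym (+-assoc (toℕ c) (toℕ v) _)) ⟩
    (toℕ c + toℕ v + (n ∸ toℕ c)) % n       ≡⟨ cong (_% n) (c+x+[n∸c]≡x+n c (toℕ v)) ⟩
    (toℕ v + n) % n                         ≡⟨ [m+n]%n≡m%n (toℕ v) n ⟩
    toℕ v % n                               ≡⟨ m<n⇒m%n≡m (toℕ<n v) ⟩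
    toℕ v                                   ∎)
    where open ≡-Reasoning

  pos-at : ∀ c p → pos c (at c p) ≡ p % n
  pos-at c p = begin
    (toℕ (at c p) + (n ∸ toℕ c)) % n     ≡⟨ cong (λ x → (x + (n ∸ toℕ c)) % n) (toℕ-at c p) ⟩
    ((toℕ c + p) % n + (n ∸ toℕ c)) % n  ≡⟨ [a%n+b]%n≡[a+b]%n (toℕ c + p) _ ⟩
    (toℕ c + p + (n ∸ toℕ c)) % n        ≡⟨ cong (_% n) (c+x+[n∸c]≡x+n c p) ⟩
    (p + n) % n                          ≡⟨ [m+n]%n≡m%n p n ⟩
    p % n                                ∎
    where open ≡-Reasoning

  pos-at-< : ∀ c {p} → p < n → pos c (at c p) ≡ p
  pos-at-< c {p} p<n = trans (pos-at c p) (m<n⇒m%n≡m p<n)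

  at-injective : ∀ c {p q} → p < n → q < n → at c p ≡ at c q → p ≡ q
  at-injective c p<n q<n eq = trans (sym (pos-at-< c p<n)) (trans (cong (pos c) eq) (pos-at-< c q<n))

  atArc : ∀ c {j} → j < n → AtArc c j (at c j)
  atArc c {j} j<n with toℕ c + j <? n
  ... | yes c+j<n = inj₁ (sym (trans (toℕ-at c j) (m<n⇒m%n≡m c+j<n)))
  ... | no  c+j≮n = inj₂ (begin
    toℕ c + j               ≡⟨ m+[n∸m]≡n n≤c+j ⟨
    n + (toℕ c + j ∸ n)     ≡⟨ cong (n +_) (m<n⇒m%n≡m c+j∸n<n) ⟨
    n + (toℕ c + j ∸ n) % n ≡⟨ cong (n +_) (m≤n⇒[n∸m]%m≡n%m n≤c+j) ⟩
    n + (toℕ c + j) % n     ≡⟨ cong (n +_) (toℕ-at c j) ⟨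
    n + toℕ (at c j)        ∎)
    where
    open ≡-Reasoning
    n≤c+j : n ≤ toℕ c + j
    n≤c+j = ≮⇒≥ c+j≮n
    c+j∸n<n : toℕ c + j ∸ n < n
    c+j∸n<n = subst (toℕ c + j ∸ n <_) (m+n∸n≡m n n) (∸-monoˡ-< (+-mono-< (toℕ<n c) j<n) n≤c+j)

  atArc-unique : ∀ c j {u v} → AtArc c j u → AtArc c j v → u ≡ v
  atArc-unique c j (inj₁ eu) (inj₁ ev) = toℕ-injective (trans (sym eu) ev)
  atArc-unique c j (inj₂ eu) (inj₂ ev) = toℕ-injective (+-cancelˡ-≡ n _ _ (trans (sym eu) ev))
  atArc-unique c j {u} {v} (inj₁ eu) (inj₂ ev) =
    contradiction (subst (_< n) (trans (sym eu) ev) (toℕ<n u)) (≤⇒≯ (m≤m+n n (toℕ v)))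
  atArc-unique c j {u} {v} (inj₂ eu) (inj₁ ev) = sym (atArc-unique c j (inj₁ ev) (inj₂ eu))

  AtArc-at : ∀ c a {j u} → j < n → AtArc (at c a) j u → u ≡ at c (a + j)
  AtArc-at c a j<n arc = trans (atArc-unique (at c a) _ arc (atArc (at c a) j<n)) (at-at c a _)

  onArc-at : ∀ c a {k j} → k < n → j ≤ k → OnArc (at c a) k (at c (a + j))
  onArc-at c a {j = j} k<n j≤k =
    j , j≤k , subst (AtArc (at c a) j) (at-at c a j) (atArc (at c a) (≤-<-trans j≤k k<n))

  [a+1+b]%n≡[1+[a+b]%n]%n : ∀ a b → (a + suc b) % n ≡ suc ((a + b) % n) % n
  [a+1+b]%n≡[1+[a+b]%n]%n a b = begin
    (a + suc b) % n       ≡⟨ cong (_% n) (trans (+-suc a b) (+-comm 1 (a + b))) ⟩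
    (a + b + 1) % n       ≡⟨ [a%n+b]%n≡[a+b]%n (a + b) 1 ⟨
    ((a + b) % n + 1) % n ≡⟨ cong (_% n) (+-comm _ 1) ⟩
    suc ((a + b) % n) % n ∎
    where open ≡-Reasoning

  walk-stays : ∀ {lo b} → b ≤ n → ∀ p t → lo ≤ p % n → p % n < b →
               (∀ {t′} → t′ ≤ t → (p + t′) % n ≢ b % n) →
               lo ≤ (p + t) % n × (p + t) % n < b
  walk-stays b≤n p zero lo≤ <b _ rewrite +-identityʳ p = lo≤ , <b
  walk-stays {lo} {b} b≤n p (suc t) lo≤ <b avoid
    with walk-stays b≤n p t lo≤ <b (avoid ∘ m≤n⇒m≤1+n)
  ... | lo≤v , v<b with m≤n⇒m<n∨m≡n v<b
  ...   | inj₁ 1+v<b = subst (λ x → lo ≤ x × x < b)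
      (sym (trans ([a+1+b]%n≡[1+[a+b]%n]%n p t) (m<n⇒m%n≡m (<-≤-trans 1+v<b b≤n))))
      (m≤n⇒m≤1+n lo≤v , 1+v<b)
  ...   | inj₂ 1+v≡b = contradiction
      (trans ([a+1+b]%n≡[1+[a+b]%n]%n p t) (cong (_% n) 1+v≡b)) (avoid ≤-refl)

  succᵇ : Fin n → Fin n → Bool
  succᵇ u v = (suc (toℕ u) ≡ᵇ toℕ v) ∨ ((suc (toℕ u) ≡ᵇ n) ∧ (toℕ v ≡ᵇ 0))

  cycAdjᵇ-succᵇ : ∀ u v → cycAdjᵇ u v ≡ succᵇ u v ∨ succᵇ v u
  cycAdjᵇ-succᵇ u v = ∨-interleave (suc (toℕ u) ≡ᵇ toℕ v) (suc (toℕ v) ≡ᵇ toℕ u) _ _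
    where
    ∨-interleave : ∀ a b c d → a ∨ b ∨ c ∨ d ≡ (a ∨ c) ∨ (b ∨ d)
    ∨-interleave true  b     c d = refl
    ∨-interleave false true  c d = sym (∨-zeroʳ c)
    ∨-interleave false false c d = refl

  toℕ-at-1 : ∀ u → toℕ (at u 1) ≡ suc (toℕ u) % n
  toℕ-at-1 u = trans (toℕ-at u 1) (cong (_% n) (+-comm (toℕ u) 1))

  succᵇ⇔ : ∀ u v → T (succᵇ u v) ⇔ v ≡ at u 1
  succᵇ⇔ u v = mk⇔ to from
    where
    to : T (succᵇ u v) → v ≡ at u 1
    to t with Equivalence.to T-∨ t
    ... | inj₁ 1+u≡v = toℕ-injective (sym (trans (toℕ-at-1 u)
            (trans (cong (_% n) (≡ᵇ⇒≡ _ _ 1+u≡v)) (m<n⇒m%n≡m (toℕ<n v)))))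
    ... | inj₂ wrap with Equivalence.to T-∧ wrap
    ...   | 1+u≡n , v≡0 = toℕ-injective (sym (trans (toℕ-at-1 u)
            (trans (cong (_% n) (≡ᵇ⇒≡ _ _ 1+u≡n)) (trans (n%n≡0 n) (sym (≡ᵇ⇒≡ _ _ v≡0))))))
    from : v ≡ at u 1 → T (succᵇ u v)
    from refl with suc (toℕ u) <? n
    ... | yes 1+u<n = Equivalence.from T-∨ (inj₁ (≡⇒≡ᵇ _ _ (sym (trans (toℕ-at-1 u) (m<n⇒m%n≡m 1+u<n)))))
    ... | no  1+u≮n = Equivalence.from T-∨ (inj₂ (Equivalence.from T-∧ (≡⇒≡ᵇ _ _ 1+u≡n ,
            ≡⇒≡ᵇ _ _ (trans (toℕ-at-1 u) (trans (cong (_% n) 1+u≡n) (n%n≡0 n))))))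
      where 1+u≡n = ≤-antisym (toℕ<n u) (≮⇒≥ 1+u≮n)

  cycAdjᵇ⇔ : ∀ u v → cycAdjᵇ u v ≡ true ⇔ (v ≡ at u 1 ⊎ u ≡ at v 1)
  cycAdjᵇ⇔ u v rewrite cycAdjᵇ-succᵇ u v =
    ((succᵇ⇔ u v ⊎-⇔ succᵇ⇔ v u) ⇔-∘ T-∨) ⇔-∘ ⇔-sym T-≡

  at-n : ∀ c → at c n ≡ c
  at-n c = trans (cong (at c) (sym (+-identityʳ n))) (trans (at-n+ c 0) (at-0 c))

  at-1-pred : ∀ v → at (at v (n ∸ 1)) 1 ≡ v
  at-1-pred v = trans (at-at v (n ∸ 1) 1) (trans (cong (at v) (m∸n+n≡m (>-nonZero⁻¹ n))) (at-n v))

  at-pred-1 : ∀ v → at (at v 1) (n ∸ 1) ≡ v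
  at-pred-1 v = trans (at-at v 1 (n ∸ 1)) (trans (cong (at v) (m+[n∸m]≡n (>-nonZero⁻¹ n))) (at-n v))

  cycle-degree : 3 ≤ n → ∀ v → countB (cycAdjᵇ v) ≡ 2
  cycle-degree 3≤n v =
    trans (countB-suc (at v 1) (adjacent (inj₁ refl)) next≢prev other) (cong suc (countB-≟ prev))
    where
    prev : Fin n
    prev = at v (n ∸ 1)
    adjacent : ∀ {x} → x ≡ at v 1 ⊎ v ≡ at x 1 → cycAdjᵇ v x ≡ true
    adjacent = Equivalence.from (cycAdjᵇ⇔ v _)
    next≢prev : does (at v 1 ≟ᶠ prev) ≡ false
    next≢prev = dec-false (at v 1 ≟ᶠ prev) λ eq →
      <⇒≢ (∸-monoˡ-≤ 1 3≤n) (at-injective v (≤-<-trans (s≤s z≤n) 3≤n) (∸-monoʳ-< z<s (>-nonZero⁻¹ n)) eq)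
    other : ∀ x → x ≢ at v 1 → cycAdjᵇ v x ≡ does (x ≟ᶠ prev)
    other x x≢next with x ≟ᶠ prev
    ... | yes refl  = adjacent (inj₂ (sym (at-1-pred v)))
    ... | no  x≢prev = ¬-not λ adj →
      [ x≢next , (λ { refl → x≢prev (sym (at-pred-1 x)) }) ] (Equivalence.to (cycAdjᵇ⇔ v x) adj)

  cycle-next : ∀ c p → cycAdjᵇ (at c p) (at c (suc p)) ≡ true
  cycle-next c p = Equivalence.from (cycAdjᵇ⇔ (at c p) (at c (suc p)))
    (inj₁ (sym (trans (at-at c p 1) (cong (at c) (+-comm p 1)))))

  pos-shift : ∀ c a v → a + pos (at c a) v < n → pos c v ≡ a + pos (at c a) v
  pos-shift c a v lt = begin
    pos c v                               ≡⟨ cong (pos c) (at-pos (at c a) v) ⟨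
    pos c (at (at c a) (pos (at c a) v))  ≡⟨ cong (pos c) (at-at c a _) ⟩
    pos c (at c (a + pos (at c a) v))     ≡⟨ pos-at-< c lt ⟩
    a + pos (at c a) v                    ∎
    where open ≡-Reasoning

module ThreeConnectivity
  (n m : ℕ) .{{_ : NonZero n}} (3≤n : 3 ≤ n) (1≤m : 1 ≤ m)
  (part : Fin n → Fin 3)
  (part-subpath : ∀ i → IsSubpathSet (λ v → part v ≡ i))
  (adj : Fin m → Fin n → Bool)
  (neighbour : ∀ s i → ∃ λ u → part u ≡ i × adj s u ≡ true ×
                 (∀ u′ → part u′ ≡ i → adj s u′ ≡ true → u′ ≡ u))
  (single-attachment : ∀ v s s′ → adj s v ≡ true → adj s′ v ≡ true → s ≡ s′)
  (f : (v : Fin n) → degree (hatE adj) (v ↑ˡ m) ≡ 2 → Fin (n + m))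
  (f-avoids-P : ∀ v d s k → IsP adj v s k → ∀ u → OnArc s k u → f v d ≢ u ↑ˡ m)
  where

  open Cycle n

  cv : Fin n → Fin (n + m)
  cv v = v ↑ˡ m

  sv : Fin m → Fin (n + m)
  sv s = n ↑ʳ s

  data Vertex : Fin (n + m) → Set where
    cycle : ∀ v → Vertex (cv v)
    new   : ∀ s → Vertex (sv s)

  vertex : ∀ x → Vertex x
  vertex x with splitAt n x in eq
  ... | inj₁ v = subst Vertex (splitAt⁻¹-↑ˡ eq) (cycle v)
  ... | inj₂ s = subst Vertex (splitAt⁻¹-↑ʳ eq) (new s)

  cv-injective : ∀ {u v} → cv u ≡ cv v → u ≡ v
  cv-injective = ↑ˡ-injective m _ _

  cv≢sv : ∀ {v s} → cv v ≢ sv s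
  cv≢sv {v} {s} eq with trans (sym (splitAt-↑ˡ n v m)) (trans (cong (splitAt n) eq) (splitAt-↑ʳ n m s))
  ... | ()

  Ĉ-cycle : ∀ u v → hatE adj (cv u) (cv v) ≡ cycAdjᵇ u v
  Ĉ-cycle u v rewrite splitAt-↑ˡ n u m | splitAt-↑ˡ n v m = refl

  Ĉ-cycle-new : ∀ v s → hatE adj (cv v) (sv s) ≡ adj s v
  Ĉ-cycle-new v s rewrite splitAt-↑ˡ n v m | splitAt-↑ʳ n m s = refl

  Ĉ-new-cycle : ∀ s v → hatE adj (sv s) (cv v) ≡ adj s v
  Ĉ-new-cycle s v rewrite splitAt-↑ˡ n v m | splitAt-↑ʳ n m s = refl

  c₀ : Fin n
  c₀ = fromℕ< (>-nonZero⁻¹ n)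

  s₀ : Fin m
  s₀ = fromℕ< 1≤m

  nbr : Fin m → Fin 3 → Fin n
  nbr s i = proj₁ (neighbour s i)

  part-nbr : ∀ s i → part (nbr s i) ≡ i
  part-nbr s i = proj₁ (proj₂ (neighbour s i))

  adj-nbr : ∀ s i → adj s (nbr s i) ≡ true
  adj-nbr s i = proj₁ (proj₂ (proj₂ (neighbour s i)))

  nbr-injective : ∀ s → Injective _≡_ _≡_ (nbr s)
  nbr-injective s {i} {j} eq = trans (sym (part-nbr s i)) (trans (cong part eq) (part-nbr s j))

  Attached : Fin n → Set
  Attached v = ∃ λ s → adj s v ≡ true

  attached? : U.Decidable Attached
  attached? v = any? (λ s → adj s v ≟ᵇ true)

  degree-cycle : ∀ v → degree (hatE adj) (cv v) ≡ 2 + countB (λ s → adj s v)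
  degree-cycle v = trans (countB-+ n (hatE adj (cv v)))
    (cong₂ _+_ (trans (countB-cong (Ĉ-cycle v)) (cycle-degree 3≤n v)) (countB-cong (Ĉ-cycle-new v)))

  attached⇒degree-3 : ∀ {v} → Attached v → degree (hatE adj) (cv v) ≡ 3
  attached⇒degree-3 {v} (s , sv-edge) = trans (degree-cycle v)
    (cong (2 +_) (countB-single s sv-edge (λ s′ s′v-edge → single-attachment v s′ s s′v-edge sv-edge)))

  unattached⇒degree-2 : ∀ {v} → ¬ Attached v → degree (hatE adj) (cv v) ≡ 2
  unattached⇒degree-2 {v} unattached =
    trans (degree-cycle v) (cong (2 +_) (countB-none (λ s e → unattached (s , e))))

  module PartAsArc (c : Fin n) (i : Fin 3) where

    sᵢ : Fin n
    sᵢ = proj₁ (part-subpath i)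

    k : ℕ
    k = proj₁ (proj₂ (part-subpath i))

    k<n : k < n
    k<n = proj₁ (proj₂ (proj₂ (part-subpath i)))

    a : ℕ
    a = pos c sᵢ

    member : ∀ {j} → j ≤ k → part (at c (a + j)) ≡ i
    member {j} j≤k = proj₂ (proj₂ (proj₂ (proj₂ (part-subpath i))) (at c (a + j)))
      (subst (λ z → OnArc z k (at c (a + j))) (at-pos c sᵢ) (onArc-at c a k<n j≤k))

    locate : ∀ {v} → part v ≡ i → ∃ λ j → j ≤ k × pos c v ≡ (a + j) % n
    locate {v} pv with proj₁ (proj₂ (proj₂ (proj₂ (part-subpath i))) v) pv
    ... | j , j≤k , arc = j , j≤k , trans
      (cong (pos c) (AtArc-at c a (≤-<-trans j≤k k<n) (subst (λ z → AtArc z j v) (sym (at-pos c sᵢ)) arc)))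
      (pos-at c (a + j))

    walk-stays-in-part : ∀ {lo b j j′} → b ≤ n → part (at c b) ≢ i → j ≤ j′ → j′ ≤ k →
            lo ≤ (a + j) % n → (a + j) % n < b → lo ≤ (a + j′) % n × (a + j′) % n < b
    walk-stays-in-part {lo} {b} {j} {j′} b≤n part-b≢i j≤j′ j′≤k lo≤ <b =
      subst (λ p → lo ≤ p % n × p % n < b) (trans (+-assoc a j _) (cong (a +_) (m+[n∸m]≡n j≤j′)))
            (walk-stays b≤n (a + j) (j′ ∸ j) lo≤ <b avoid)
      where
      avoid : ∀ {t} → t ≤ j′ ∸ j → (a + j + t) % n ≢ b % n
      avoid {t} t≤ eq = part-b≢i (begin
        part (at c b)                 ≡⟨ cong part (at-% c b) ⟨
        part (at c (b % n))           ≡⟨ cong (part ∘ at c) eq ⟨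
        part (at c ((a + j + t) % n)) ≡⟨ cong part (at-% c (a + j + t)) ⟩
        part (at c (a + j + t))       ≡⟨ cong (part ∘ at c) (+-assoc a j t) ⟩
        part (at c (a + (j + t)))     ≡⟨ member (≤-trans (+-monoʳ-≤ j t≤) (≤-trans (≤-reflexive (m+[n∸m]≡n j≤j′)) j′≤k)) ⟩
        i                             ∎)
        where open ≡-Reasoning

  module Deleted (X : List (Fin (n + m))) where

    infix 4 _⇝_
    _⇝_ : Fin (n + m) → Fin (n + m) → Set
    _⇝_ = Reach (tildeE adj f) X

    cycle-edge : ∀ {u v} → cycAdjᵇ u v ≡ true → cv v ∉ X → cv u ⇝ cv v
    cycle-edge e = reach-edge (inj₁ (trans (Ĉ-cycle _ _) e))

    cycle-edge⁻ : ∀ {u v} → cycAdjᵇ v u ≡ true → cv v ∉ X → cv u ⇝ cv v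
    cycle-edge⁻ e = reach-edge⁻ (inj₁ (trans (Ĉ-cycle _ _) e))

    attach-edge : ∀ {s v} → adj s v ≡ true → sv s ∉ X → cv v ⇝ sv s
    attach-edge e = reach-edge (inj₁ (trans (Ĉ-cycle-new _ _) e))

    attach-edge⁻ : ∀ {s v} → adj s v ≡ true → cv v ∉ X → sv s ⇝ cv v
    attach-edge⁻ e = reach-edge (inj₁ (trans (Ĉ-new-cycle _ _) e))

    f-edge : ∀ {v} (d : degree (hatE adj) (cv v) ≡ 2) → f v d ∉ X → cv v ⇝ f v d
    f-edge d = reach-edge (inj₂ (_ , d , refl , refl))

    arc-walk : ∀ c {a b} → (∀ {j} → a ≤ j → j < b → cv (at c j) ∉ X) →
               ∀ {p} → a ≤ p → p < b → cv (at c p) ⇝ cv (at c a)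
    arc-walk c {a} {b} kept {p} a≤p p<b =
      subst (λ x → cv (at c x) ⇝ cv (at c a)) (m+[n∸m]≡n a≤p)
            (go (p ∸ a) (subst (_< b) (sym (m+[n∸m]≡n a≤p)) p<b))
      where
      go : ∀ d → a + d < b → cv (at c (a + d)) ⇝ cv (at c a)
      go zero    _       = subst (λ x → cv (at c x) ⇝ cv (at c a)) (sym (+-identityʳ a)) here
      go (suc d) a+d+1<b = reach-trans
        (subst (λ x → cv (at c x) ⇝ cv (at c (a + d))) (sym (+-suc a d))
               (cycle-edge⁻ (cycle-next c (a + d)) (kept (m≤m+n a d) a+d<b)))
        (go d a+d<b)
        where a+d<b : a + d < b
              a+d<b = <-trans (+-monoʳ-< a (n<1+n d)) a+d+1<b

    arc-reach : ∀ c {a b} → (∀ {j} → a ≤ j → j < b → cv (at c j) ∉ X) →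
                ∀ {v} → a ≤ pos c v → pos c v < b → cv v ⇝ cv (at c a)
    arc-reach c kept {v} a≤p p<b = subst (λ x → cv x ⇝ _) (at-pos c v) (arc-walk c kept a≤p p<b)

    Hub : Set
    Hub = ∃ λ r → ∀ v → cv v ∉ X → cv v ⇝ r

    hub-connects : length X ≤ 2 → Hub → ∀ {x y} → x ∉ X → y ∉ X → x ⇝ y
    hub-connects |X|≤2 (r , cycle-to-r) x∉X y∉X =
      reach-trans (to-r _ (vertex _) x∉X) (reach-sym y∉X (to-r _ (vertex _) y∉X))
      where
      to-r : ∀ x → Vertex x → x ∉ X → x ⇝ r
      to-r _ (cycle v) v∉X = cycle-to-r v v∉X
      to-r _ (new s)   _   with injective-escapes _≟ᶠ_ {f = cv ∘ nbr s} (nbr-injective s ∘ cv-injective) X (s≤s |X|≤2)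
      ... | i , w∉X = reach-trans (attach-edge⁻ (adj-nbr s i) w∉X) (cycle-to-r (nbr s i) w∉X)

    hub-within-one : ∀ c → (∀ {v} → cv v ∈ X → v ≡ c) → Hub
    hub-within-one c deleted = cv (at c 1) , to-at-c-1
      where
      kept : ∀ {j} → 1 ≤ j → j < n → cv (at c j) ∉ X
      kept 1≤j j<n j∈X = <⇒≢ 1≤j (sym (at-injective c j<n (>-nonZero⁻¹ n) (trans (deleted j∈X) (sym (at-0 c)))))
      to-at-c-1 : ∀ v → cv v ∉ X → cv v ⇝ cv (at c 1)
      to-at-c-1 v v∉X with pos c v ≟ 0
      ... | no  p≢0 = arc-reach c kept (n≢0⇒n>0 p≢0) (pos<n c v)
      ... | yes p≡0 = subst (λ x → cv x ⇝ cv (at c 1)) (trans (cong (at c) (sym p≡0)) (at-pos c v))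
                            (cycle-edge (cycle-next c 0) (kept ≤-refl (<-≤-trans (s≤s (s≤s z≤n)) 3≤n)))

    module TwoArcs (c : Fin n) (q : ℕ) (2≤q : 2 ≤ q) (q+2≤n : q + 2 ≤ n)
                   (kept : ∀ {v} → v ≢ c → v ≢ at c q → cv v ∉ X)
                   (new-kept : ∀ s → sv s ∉ X) where

      q<n : q < n
      q<n = <-≤-trans (m<m+n q z<s) q+2≤n

      InA InB : Fin n → Set
      InA v = 1 ≤ pos c v × pos c v < q
      InB v = q < pos c v

      a₁ b₁ : Fin n
      a₁ = at c 1
      b₁ = at c (suc q)

      InA-at : ∀ {j} → 1 ≤ j → j < q → InA (at c j)
      InA-at 1≤j j<q = subst (λ p → 1 ≤ p × p < q) (sym (pos-at-< c (<-trans j<q q<n))) (1≤j , j<q)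

      InB-at : ∀ {j} → q < j → j < n → InB (at c j)
      InB-at q<j j<n = subst (q <_) (sym (pos-at-< c j<n)) q<j

      pos-c : pos c c ≡ 0
      pos-c = subst (λ x → pos c x ≡ 0) (at-0 c) (pos-at-< c (>-nonZero⁻¹ n))

      side : ∀ {v} → v ≢ c → v ≢ at c q → InA v ⊎ InB v
      side {v} v≢c v≢cq with <-cmp (pos c v) q
      ... | tri< p<q _ _ = inj₁ (n≢0⇒n>0 (λ p≡0 → v≢c (trans (sym (at-pos c v)) (trans (cong (at c) p≡0) (at-0 c)))) , p<q)
      ... | tri≈ _ p≡q _ = ⊥-elim (v≢cq (trans (sym (at-pos c v)) (cong (at c) p≡q)))
      ... | tri> _ _ q<p = inj₂ q<p

      kept-side : ∀ {v} → InA v ⊎ InB v → cv v ∉ X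
      kept-side {v} v∈AB = kept (λ { refl → not-c v∈AB }) (λ { refl → not-cq v∈AB })
        where
        not-c : InA c ⊎ InB c → ⊥
        not-c (inj₁ (1≤p , _)) = <⇒≢ 1≤p (sym pos-c)
        not-c (inj₂ q<p)       = <⇒≢ (≤-<-trans z≤n q<p) (sym pos-c)
        not-cq : InA (at c q) ⊎ InB (at c q) → ⊥
        not-cq (inj₁ (_ , p<q)) = <⇒≢ p<q (pos-at-< c q<n)
        not-cq (inj₂ q<p)       = <⇒≢ q<p (sym (pos-at-< c q<n))

      A-walk : ∀ {v} → InA v → cv v ⇝ cv a₁
      A-walk (1≤p , p<q) = arc-reach c (λ 1≤j j<q → kept-side (inj₁ (InA-at 1≤j j<q))) 1≤p p<q

      B-walk : ∀ {v} → InB v → cv v ⇝ cv b₁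
      B-walk {v} q<p = arc-reach c (λ q<j j<n → kept-side (inj₂ (InB-at q<j j<n))) q<p (pos<n c v)

      via-new : ∀ s {x y} → InA x → InB y → adj s x ≡ true → adj s y ≡ true → cv a₁ ⇝ cv b₁
      via-new s x∈A y∈B sx sy =
        reach-trans (reach-sym (kept-side (inj₁ x∈A)) (A-walk x∈A))
          (reach-trans (attach-edge sx (new-kept s))
            (reach-trans (attach-edge⁻ sy (kept-side (inj₂ y∈B))) (B-walk y∈B)))

      separated : ∀ {i x y} → part c ≢ i → part (at c q) ≢ i →
                  InA x → InB y → part x ≡ i → part y ≡ i → ⊥
      separated {i} {y = y} part-c≢i part-cq≢i (1≤px , px<q) q<py part-x part-y
        with PartAsArc.locate c i part-x | PartAsArc.locate c i part-y
      ... | jx , jx≤k , px≡ | jy , jy≤k , py≡ with ≤-total jx jy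
      ...   | inj₁ jx≤jy = <-asym q<py (subst (_< q) (sym py≡) (proj₂
                (PartAsArc.walk-stays-in-part c i (<⇒≤ q<n) part-cq≢i jx≤jy jy≤k (subst (1 ≤_) px≡ 1≤px) (subst (_< q) px≡ px<q))))
      ...   | inj₂ jy≤jx = <-asym px<q (subst (q <_) (sym px≡) (proj₁
                (PartAsArc.walk-stays-in-part c i ≤-refl (part-c≢i ∘ trans (cong part (sym (at-n c)))) jy≤jx jx≤k
                               (subst (q <_) py≡ q<py) (subst (_< n) py≡ (pos<n c y)))))

      third-part : ∃ λ i → i ∉ part c ∷ part (at c q) ∷ []
      third-part = injective-escapes _≟ᶠ_ {f = λ i → i} (λ eq → eq) _ ≤-refl

      i₃ : Fin 3
      i₃ = proj₁ third-part

      part-c≢i₃ : part c ≢ i₃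
      part-c≢i₃ eq = proj₂ third-part (here (sym eq))

      part-cq≢i₃ : part (at c q) ≢ i₃
      part-cq≢i₃ eq = proj₂ third-part (there (here (sym eq)))

      nbr-side : ∀ s → InA (nbr s i₃) ⊎ InB (nbr s i₃)
      nbr-side s = side (λ eq → part-c≢i₃ (trans (cong part (sym eq)) (part-nbr s i₃)))
                        (λ eq → part-cq≢i₃ (trans (cong part (sym eq)) (part-nbr s i₃)))

      bridge-attached : ∀ {x y} → InA x → InB y → Attached x → Attached y → cv a₁ ⇝ cv b₁
      bridge-attached x∈A y∈B (s , sx) (s′ , s′y) with nbr-side s | nbr-side s′
      ... | inj₂ w∈B | _         = via-new s x∈A w∈B sx (adj-nbr s i₃)
      ... | inj₁ _   | inj₁ w′∈A = via-new s′ w′∈A y∈B (adj-nbr s′ i₃) s′y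
      ... | inj₁ w∈A | inj₂ w′∈B = ⊥-elim (separated part-c≢i₃ part-cq≢i₃ w∈A w′∈B (part-nbr s i₃) (part-nbr s′ i₃))

      -- Positions are taken in [1, n], so that c itself has position n. P(a₁) runs from the
      -- last attached position b, through c, to the first attached position e ≥ q.
      module UnattachedA (unattached : ∀ {v} → InA v → ¬ Attached v) where

        Q : ℕ → Set
        Q j = 1 ≤ j × Attached (at c j)

        Q? : U.Decidable Q
        Q? j = (1 ≤? j) ×-dec attached? (at c j)

        pos⁺ : Fin n → ℕ
        pos⁺ u = suc (pos a₁ u)

        at-pos⁺ : ∀ u → at c (pos⁺ u) ≡ u
        at-pos⁺ u = trans (sym (at-at c 1 (pos a₁ u))) (at-pos a₁ u)

        pos⁺<1+n : ∀ u → pos⁺ u < suc n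
        pos⁺<1+n u = s≤s (pos<n a₁ u)

        Q-nbr : ∀ i → Q (pos⁺ (nbr s₀ i))
        Q-nbr i = s≤s z≤n , s₀ , subst (λ u → adj s₀ u ≡ true) (sym (at-pos⁺ (nbr s₀ i))) (adj-nbr s₀ i)

        first : ∃ λ e → Q e × (∀ {j} → j < e → ¬ Q j)
        first = least Q? (suc n) (_ , pos⁺<1+n (nbr s₀ F.zero) , Q-nbr F.zero)

        last : ∃ λ b → b < suc n × Q b × (∀ {j} → b < j → j < suc n → ¬ Q j)
        last = greatest Q? (suc n) (_ , pos⁺<1+n (nbr s₀ F.zero) , Q-nbr F.zero)

        e b : ℕ
        e = proj₁ first
        b = proj₁ last

        Q-e : Q e
        Q-e = proj₁ (proj₂ first)

        Q-b : Q b
        Q-b = proj₁ (proj₂ (proj₂ last))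

        b≤n : b ≤ n
        b≤n = s≤s⁻¹ (proj₁ (proj₂ last))

        e≤nbr : ∀ i → e ≤ pos⁺ (nbr s₀ i)
        e≤nbr i = ≮⇒≥ (λ lt → proj₂ (proj₂ first) lt (Q-nbr i))

        nbr≤b : ∀ i → pos⁺ (nbr s₀ i) ≤ b
        nbr≤b i = ≮⇒≥ (λ lt → proj₂ (proj₂ (proj₂ last)) lt (pos⁺<1+n _) (Q-nbr i))

        e<b : e < b
        e<b = ≤∧≢⇒< (≤-trans (e≤nbr F.zero) (nbr≤b F.zero)) λ e≡b →
          case (nbr-injective s₀ (trans (sym (at-pos⁺ _))
                 (trans (cong (at c) (trans (squeeze F.zero e≡b) (sym (squeeze (F.suc F.zero) e≡b))))
                        (at-pos⁺ _)))) of λ ()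
          where
          squeeze : ∀ i → e ≡ b → pos⁺ (nbr s₀ i) ≡ e
          squeeze i e≡b = ≤-antisym (≤-trans (nbr≤b i) (≤-reflexive (sym e≡b))) (e≤nbr i)

        q≤e : q ≤ e
        q≤e = ≮⇒≥ λ e<q → unattached (InA-at (proj₁ Q-e) e<q) (proj₂ Q-e)

        len : ℕ
        len = n ∸ b + e

        len<n : len < n
        len<n = <-≤-trans (+-monoʳ-< (n ∸ b) e<b) (≤-reflexive (m∸n+n≡m b≤n))

        wrap : ∀ x → at c (b + (n ∸ b + x)) ≡ at c x
        wrap x = trans (cong (at c) (trans (sym (+-assoc b (n ∸ b) x)) (cong (_+ x) (m+[n∸m]≡n b≤n))))
                       (at-n+ c x)

        interior-unattached : ∀ {j} → 0 < j → j < len → ¬ Attached (at c (b + j))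
        interior-unattached {j} 0<j j<len att with j ≤? n ∸ b
        ... | yes j≤n∸b = proj₂ (proj₂ (proj₂ last)) (m<m+n b 0<j)
                            (s≤s (≤-trans (+-monoʳ-≤ b j≤n∸b) (≤-reflexive (m+[n∸m]≡n b≤n))))
                            (≤-trans 0<j (m≤n+m j b) , att)
        ... | no  j≰n∸b = proj₂ (proj₂ first) r<e (m<n⇒0<n∸m n∸b<j , subst Attached at-r att)
          where
          n∸b<j : n ∸ b < j
          n∸b<j = ≰⇒> j≰n∸b
          r : ℕ
          r = j ∸ (n ∸ b)
          n∸b+r≡j : n ∸ b + r ≡ j
          n∸b+r≡j = m+[n∸m]≡n (<⇒≤ n∸b<j)
          r<e : r < e
          r<e = +-cancelˡ-< (n ∸ b) r e (subst (_< len) (sym n∸b+r≡j) j<len)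
          at-r : at c (b + j) ≡ at c r
          at-r = trans (cong (λ z → at c (b + z)) (sym n∸b+r≡j)) (wrap r)

        P-isP : IsP adj a₁ (at c b) len
        P-isP = len<n , a₁-on-P , attached⇒degree-3 (proj₂ Q-b) , end-degree , interior-degree
          where
          a₁-on-P : OnArc (at c b) len a₁
          a₁-on-P = subst (OnArc (at c b) len) (wrap 1) (onArc-at c b len<n (+-monoʳ-≤ (n ∸ b) (proj₁ Q-e)))
          end-degree : ∀ u → AtArc (at c b) len u → degree (hatE adj) (cv u) ≡ 3
          end-degree u arc = subst (λ z → degree (hatE adj) (cv z) ≡ 3)
            (sym (trans (AtArc-at c b len<n arc) (wrap e))) (attached⇒degree-3 (proj₂ Q-e))
          interior-degree : ∀ j u → 0 < j → j < len → AtArc (at c b) j u → degree (hatE adj) (cv u) ≡ 2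
          interior-degree j u 0<j j<len arc = subst (λ z → degree (hatE adj) (cv z) ≡ 2)
            (sym (AtArc-at c b (<-trans j<len len<n) arc)) (unattached⇒degree-2 (interior-unattached 0<j j<len))

        P-covers : ∀ {v} → ¬ InB v → OnArc (at c b) len v
        P-covers {v} v∉B = subst (OnArc (at c b) len) (trans (wrap (pos c v)) (at-pos c v))
          (onArc-at c b len<n (+-monoʳ-≤ (n ∸ b) (≤-trans (≮⇒≥ v∉B) q≤e)))

        degree-a₁ : degree (hatE adj) (cv a₁) ≡ 2
        degree-a₁ = unattached⇒degree-2 (unattached (InA-at ≤-refl 2≤q))

        bridge-by-f : cv a₁ ⇝ cv b₁
        bridge-by-f = via-target (vertex (f a₁ degree-a₁))
          (λ u u∉B → f-avoids-P a₁ degree-a₁ (at c b) len P-isP u (P-covers u∉B)) (f-edge degree-a₁)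
          where
          via-target : ∀ {x} → Vertex x → (∀ u → ¬ InB u → x ≢ cv u) → (x ∉ X → cv a₁ ⇝ x) → cv a₁ ⇝ cv b₁
          via-target (cycle u) off-P edge with q <? pos c u
          ... | yes u∈B = reach-trans (edge (kept-side (inj₂ u∈B))) (B-walk u∈B)
          ... | no  u∉B = ⊥-elim (off-P u u∉B refl)
          via-target (new s) _ edge with nbr-side s
          ... | inj₁ w∈A = ⊥-elim (unattached w∈A (s , adj-nbr s i₃))
          ... | inj₂ w∈B = reach-trans (edge (new-kept s))
                  (reach-trans (attach-edge⁻ (adj-nbr s i₃) (kept-side (inj₂ w∈B))) (B-walk w∈B))

      bridge-unless-B-unattached : cv a₁ ⇝ cv b₁ ⊎ (∀ {v} → InB v → ¬ Attached v)
      bridge-unless-B-unattached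
        with any? (λ v → ((1 ≤? pos c v) ×-dec (pos c v <? q)) ×-dec attached? v)
           | any? (λ v → (q <? pos c v) ×-dec attached? v)
      ... | yes (_ , x∈A , ax) | yes (_ , y∈B , ay) = inj₁ (bridge-attached x∈A y∈B ax ay)
      ... | no  noneA          | _                  = inj₁ (UnattachedA.bridge-by-f λ x∈A ax → noneA (_ , x∈A , ax))
      ... | yes _              | no noneB           = inj₂ λ y∈B ay → noneB (_ , y∈B , ay)

    two-arc-bridge : ∀ c q → 2 ≤ q → q + 2 ≤ n →
                     (∀ {v} → v ≢ c → v ≢ at c q → cv v ∉ X) → (∀ s → sv s ∉ X) →
                     cv (at c 1) ⇝ cv (at c (suc q))
    two-arc-bridge c q 2≤q q+2≤n kept new-kept
      with TwoArcs.bridge-unless-B-unattached c q 2≤q q+2≤n kept new-kept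
    ... | inj₁ bridge       = bridge
    ... | inj₂ B-unattached =
      -- exchange the roles of A and B by counting positions from at c q
      subst₂ (λ x y → cv x ⇝ cv y) at-c′-q′+1 at-c′-1
        (reach-sym (Rotated.kept-side (inj₁ (Rotated.InA-at ≤-refl 2≤q′)))
                   (Rotated.UnattachedA.bridge-by-f A′-unattached))
      where
      c′ : Fin n
      c′ = at c q
      q′ : ℕ
      q′ = n ∸ q
      q≤n : q ≤ n
      q≤n = m+n≤o⇒m≤o q q+2≤n
      2≤q′ : 2 ≤ q′
      2≤q′ = m+n≤o⇒m≤o∸n 2 (subst (_≤ n) (+-comm q 2) q+2≤n)
      q′+2≤n : q′ + 2 ≤ n
      q′+2≤n = ≤-trans (+-monoʳ-≤ q′ 2≤q) (≤-reflexive (m∸n+n≡m q≤n))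
      at-c′-q′ : at c′ q′ ≡ c
      at-c′-q′ = trans (at-at c q q′) (trans (cong (at c) (m+[n∸m]≡n q≤n)) (at-n c))
      at-c′-1 : at c′ 1 ≡ at c (suc q)
      at-c′-1 = trans (at-at c q 1) (cong (at c) (+-comm q 1))
      at-c′-q′+1 : at c′ (suc q′) ≡ at c 1
      at-c′-q′+1 = trans (at-at c q (suc q′))
                         (trans (cong (at c) (trans (+-suc q q′) (trans (cong suc (m+[n∸m]≡n q≤n)) (+-comm 1 n))))
                                (at-n+ c 1))
      module Rotated = TwoArcs c′ q′ 2≤q′ q′+2≤n
        (λ v≢c′ v≢end → kept (λ v≡c → v≢end (trans v≡c (sym at-c′-q′))) v≢c′) new-kept
      A′-unattached : ∀ {v} → Rotated.InA v → ¬ Attached v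
      A′-unattached {v} (1≤p , p<q′) = B-unattached (subst (q <_) (sym (pos-shift c q v q+p<n)) (m<m+n q 1≤p))
        where q+p<n = <-≤-trans (+-monoʳ-< q p<q′) (≤-reflexive (m+[n∸m]≡n q≤n))

  hub-two : ∀ {c₁ c₂} → c₁ ≢ c₂ → Deleted.Hub (cv c₁ ∷ cv c₂ ∷ [])
  hub-two {c₁} {c₂} c₁≢c₂ = hub
    where
    open Deleted (cv c₁ ∷ cv c₂ ∷ [])
    X : List (Fin (n + m))
    X = cv c₁ ∷ cv c₂ ∷ []
    q : ℕ
    q = pos c₁ c₂

    kept : ∀ {v} → v ≢ c₁ → v ≢ at c₁ q → cv v ∉ X
    kept v≢c₁ _    (here eq)         = v≢c₁ (cv-injective eq)
    kept _    v≢c₂ (there (here eq)) = v≢c₂ (trans (cv-injective eq) (sym (at-pos c₁ c₂)))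

    new-kept : ∀ s → sv s ∉ X
    new-kept s (here eq)         = cv≢sv (sym eq)
    new-kept s (there (here eq)) = cv≢sv (sym eq)

    kept-at : ∀ {j} → j < n → 0 < j → j ≢ q → cv (at c₁ j) ∉ X
    kept-at j<n 0<j j≢q = kept (λ eq → >⇒≢ 0<j (at-injective c₁ j<n (>-nonZero⁻¹ n) (trans eq (sym (at-0 c₁)))))
                               (j≢q ∘ at-injective c₁ j<n (pos<n c₁ c₂))

    ≢c₁ : ∀ {v} → cv v ∉ X → v ≢ c₁
    ≢c₁ v∉X eq = v∉X (here (cong cv eq))

    ≢c₂ : ∀ {v} → cv v ∉ X → v ≢ at c₁ q
    ≢c₂ v∉X eq = v∉X (there (here (cong cv (trans eq (at-pos c₁ c₂)))))

    pos≢0 : ∀ {v} → cv v ∉ X → pos c₁ v ≢ 0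
    pos≢0 {v} v∉X p≡0 = ≢c₁ v∉X (trans (sym (at-pos c₁ v)) (trans (cong (at c₁) p≡0) (at-0 c₁)))

    pos≢q : ∀ {v} → cv v ∉ X → pos c₁ v ≢ q
    pos≢q {v} v∉X p≡q = ≢c₂ v∉X (trans (sym (at-pos c₁ v)) (cong (at c₁) p≡q))

    q≢0 : q ≢ 0
    q≢0 q≡0 = c₁≢c₂ (trans (sym (at-0 c₁)) (trans (cong (at c₁) (sym q≡0)) (at-pos c₁ c₂)))

    ≢0∧≢1⇒2≤ : ∀ {p} → p ≢ 0 → p ≢ 1 → 2 ≤ p
    ≢0∧≢1⇒2≤ {0}           p≢0 _   = contradiction refl p≢0
    ≢0∧≢1⇒2≤ {1}           _   p≢1 = contradiction refl p≢1
    ≢0∧≢1⇒2≤ {suc (suc p)} _   _   = s≤s (s≤s z≤n)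

    hub : Hub
    hub with q ≟ 1 | q ≟ n ∸ 1
    ... | yes q≡1 | _ = cv (at c₁ 2) , λ v v∉X →
      arc-reach c₁ (λ 2≤j j<n → kept-at j<n (<⇒≤ 2≤j) (λ j≡q → >⇒≢ 2≤j (trans j≡q q≡1)))
                   (≢0∧≢1⇒2≤ (pos≢0 v∉X) (λ p≡1 → pos≢q v∉X (trans p≡1 (sym q≡1)))) (pos<n c₁ v)
    ... | no _ | yes q≡n∸1 = cv (at c₁ 1) , λ v v∉X →
      arc-reach c₁ (λ 1≤j j<n∸1 → kept-at (<-≤-trans j<n∸1 pred[n]≤n) 1≤j (λ j≡q → <⇒≢ j<n∸1 (trans j≡q q≡n∸1)))
                   (n≢0⇒n>0 (pos≢0 v∉X)) (≤∧≢⇒< (<⇒≤pred (pos<n c₁ v)) (λ p≡n∸1 → pos≢q v∉X (trans p≡n∸1 (sym q≡n∸1))))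
    ... | no q≢1 | no q≢n∸1 = cv (at c₁ 1) , λ v v∉X →
      [ A-walk , (λ v∈B → reach-trans (B-walk v∈B) (reach-sym (kept-side (inj₁ (InA-at ≤-refl 2≤q))) bridge)) ]
        (side (≢c₁ v∉X) (≢c₂ v∉X))
      where
      2≤q : 2 ≤ q
      2≤q = ≢0∧≢1⇒2≤ q≢0 q≢1
      q+2≤n : q + 2 ≤ n
      q+2≤n = subst (_≤ n) (+-comm 2 q) (≤∧≢⇒< (pos<n c₁ c₂) (λ eq → q≢n∸1 (cong pred eq)))
      open TwoArcs c₁ q 2≤q q+2≤n kept new-kept
      bridge : cv (at c₁ 1) ⇝ cv (at c₁ (suc q))
      bridge = two-arc-bridge c₁ q 2≤q q+2≤n kept new-kept

  data CycleDeletion (X : List (Fin (n + m))) : Set where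
    within-one  : (c : Fin n) → (∀ {v} → cv v ∈ X → v ≡ c) → CycleDeletion X
    exactly-two : ∀ {c₁ c₂} → c₁ ≢ c₂ → X ≡ cv c₁ ∷ cv c₂ ∷ [] → CycleDeletion X

  cycle-deletion : ∀ X → length X ≤ 2 → CycleDeletion X
  cycle-deletion [] _ = within-one c₀ λ ()
  cycle-deletion (x ∷ []) _ with vertex x
  ... | cycle c = within-one c λ { (here eq) → cv-injective eq }
  ... | new s   = within-one c₀ λ { (here eq) → ⊥-elim (cv≢sv eq) }
  cycle-deletion (x ∷ y ∷ []) _ with vertex x | vertex y
  ... | cycle c | cycle c′ with c ≟ᶠ c′
  ...   | yes refl = within-one c λ { (here eq) → cv-injective eq ; (there (here eq)) → cv-injective eq }
  ...   | no c≢c′  = exactly-two c≢c′ refl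
  cycle-deletion (x ∷ y ∷ []) _ | cycle c | new s =
    within-one c λ { (here eq) → cv-injective eq ; (there (here eq)) → ⊥-elim (cv≢sv eq) }
  cycle-deletion (x ∷ y ∷ []) _ | new s | cycle c =
    within-one c λ { (here eq) → ⊥-elim (cv≢sv eq) ; (there (here eq)) → cv-injective eq }
  cycle-deletion (x ∷ y ∷ []) _ | new s | new s′ =
    within-one c₀ λ { (here eq) → ⊥-elim (cv≢sv eq) ; (there (here eq)) → ⊥-elim (cv≢sv eq) }
  cycle-deletion (_ ∷ _ ∷ _ ∷ _) (s≤s (s≤s ()))

  cycle-hub : ∀ X → length X ≤ 2 → Deleted.Hub X
  cycle-hub X |X|≤2 with cycle-deletion X |X|≤2
  ... | within-one c deleted  = Deleted.hub-within-one X c deleted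
  ... | exactly-two c₁≢c₂ refl = hub-two c₁≢c₂

  three-connected : ThreeConnected (tildeE adj f)
  three-connected = +-mono-≤ 3≤n 1≤m , λ X |X|≤2 u w u∉X w∉X →
    Deleted.hub-connects X |X|≤2 (cycle-hub X |X|≤2) u∉X w∉X

corollary4p5 :
    (n m : ℕ) → 3 ≤ n → 1 ≤ m →
    (part : Fin n → Fin 3) →
    (∀ i → ∃ λ v → part v ≡ i) →
    (∀ i → IsSubpathSet (λ v → part v ≡ i)) →
    (adj : Fin m → Fin n → Bool) →
    (∀ s i → ∃ λ u → part u ≡ i × adj s u ≡ true ×
       (∀ u′ → part u′ ≡ i → adj s u′ ≡ true → u′ ≡ u)) →
    (∀ v s s′ → adj s v ≡ true → adj s′ v ≡ true → s ≡ s′) →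
    (f : (v : Fin n) → degree (hatE adj) (v ↑ˡ m) ≡ 2 → Fin (n + m)) →
    (∀ v d s k → IsP adj v s k → ∀ u → OnArc s k u → f v d ≢ u ↑ˡ m) →
    ThreeConnected (tildeE adj f)
corollary4p5 n m 3≤n 1≤m part _ part-subpath adj neighbour single-attachment f f-avoids-P =
  ThreeConnectivity.three-connected n m {{>-nonZero (≤-trans (s≤s z≤n) 3≤n)}} 3≤n 1≤m
    part part-subpath adj neighbour single-attachment f f-avoids-P
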